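{- Let $N$ and $r \ge 2$ be positive integers. Suppose $1 \le d_1 < d_2 < \dots < d_r$ and $e_1,\dots,e_r$ are positive integers with $N^2 = (N-d_i)(N+e_i)$ for each $i$. Suppose further that for each $i \in \{1,\dots,r\}$ there are positive integers $\mu_i, x_i, y_i$ with $y_i > x_i$ such that $$2N = \mu_i x_i y_i,\qquad 2(N-d_i) = \mu_i x_i^2,\qquad 2(N+e_i) = \mu_i y_i^2,$$ and set $c_i := y_i - x_i \ge 1$. Then for all $i \neq j$ in $\{1,\dots,r\}$ we have $\mu_i c_i^2 \neq \mu_j c_j^2$. -}

module Defs where

module Submission where

-- Expanding the square,
--   μ (y - x)² = μy² - 2μxy + μx² = 2(N + e) - 4N + 2(N - d) = 2(e - d),
-- so μ c² records exactly the gap  e - d.  On the other hand N² = (N - d)(N + e)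
-- expands to  d e = N (e - d).  Hence two indices with equal μ c² have a common
-- gap k = e - d and equal products d e = N k.  But for a fixed gap k the
-- product d (d + k) is strictly increasing in d, and the d's are distinct, so
-- this is impossible.

open import Defs
open import Data.Nat using (ℕ; _≤_; _<_)
open import Data.Fin using (Fin) renaming (_<_ to _<ᶠ_)
open import Data.Integer using (ℤ; +_; _-_) renaming (_*_ to _*ℤ_; _+_ to _+ℤ_)
open import Relation.Binary.PropositionalEquality using (_≡_; _≢_)
open import Data.Nat using () renaming (_*_ to _*ℕ_; _∸_ to _∸ℕ_)

open import Relation.Binary.PropositionalEquality
  using (refl; sym; trans; cong; cong₂; module ≡-Reasoning)
import Data.Nat as ℕ
import Data.Nat.Properties as ℕP
import Data.Integer.Properties as ℤP
open import Data.Integer.Solver using (module +-*-Solver)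
open +-*-Solver
open import Data.Fin.Properties using (<-cmp)
open import Relation.Binary.Definitions using (tri<; tri≈; tri>)
open import Data.Empty using (⊥)

pos-∸ : ∀ y x → x ≤ y → + (y ∸ℕ x) ≡ + y - + x
pos-∸ y x x≤y = trans (sym (ℤP.≤-⊖ x≤y)) (sym (ℤP.m-n≡m⊖n y x))

scaled-gap-square : ∀ (N d e μ x y : ℤ) →
  + 2 *ℤ N ≡ μ *ℤ x *ℤ y →
  + 2 *ℤ (N - d) ≡ μ *ℤ (x *ℤ x) →
  + 2 *ℤ (N +ℤ e) ≡ μ *ℤ (y *ℤ y) →
  μ *ℤ ((y - x) *ℤ (y - x)) ≡ + 2 *ℤ (e - d)
scaled-gap-square N d e μ x y hxy hxx hyy = begin
    μ *ℤ ((y - x) *ℤ (y - x))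
  ≡⟨ solve 3 (λ m a b → m :* ((b :- a) :* (b :- a))
                      := m :* (b :* b) :- con (+ 2) :* (m :* a :* b) :+ m :* (a :* a))
             refl μ x y ⟩
    μ *ℤ (y *ℤ y) - + 2 *ℤ (μ *ℤ x *ℤ y) +ℤ μ *ℤ (x *ℤ x)
  ≡⟨ cong₂ (λ u v → u - + 2 *ℤ v +ℤ μ *ℤ (x *ℤ x)) (sym hyy) (sym hxy) ⟩
    + 2 *ℤ (N +ℤ e) - + 2 *ℤ (+ 2 *ℤ N) +ℤ μ *ℤ (x *ℤ x)
  ≡⟨ cong (+ 2 *ℤ (N +ℤ e) - + 2 *ℤ (+ 2 *ℤ N) +ℤ_) (sym hxx) ⟩
    + 2 *ℤ (N +ℤ e) - + 2 *ℤ (+ 2 *ℤ N) +ℤ + 2 *ℤ (N - d)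
  ≡⟨ solve 3 (λ n a b → con (+ 2) :* (n :+ b) :- con (+ 2) :* (con (+ 2) :* n)
                          :+ con (+ 2) :* (n :- a)
                      := con (+ 2) :* (b :- a))
             refl N d e ⟩
    + 2 *ℤ (e - d)
  ∎
  where open ≡-Reasoning

product-from-square : ∀ (N d e : ℤ) →
  N *ℤ N ≡ (N - d) *ℤ (N +ℤ e) → d *ℤ e ≡ N *ℤ (e - d)
product-from-square N d e hN = begin
    d *ℤ e
  ≡⟨ solve 3 (λ n a b → a :* b := n :* n :- (n :- a) :* (n :+ b) :+ n :* (b :- a))
             refl N d e ⟩
    N *ℤ N - (N - d) *ℤ (N +ℤ e) +ℤ N *ℤ (e - d)
  ≡⟨ cong (λ u → N *ℤ N - u +ℤ N *ℤ (e - d)) (sym hN) ⟩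
    N *ℤ N - N *ℤ N +ℤ N *ℤ (e - d)
  ≡⟨ solve 2 (λ n k → n :* n :- n :* n :+ k := k) refl N (N *ℤ (e - d)) ⟩
    N *ℤ (e - d)
  ∎
  where open ≡-Reasoning

equal-gaps : ∀ (d₁ e₁ d₂ e₂ : ℕ) →
  + e₁ - + d₁ ≡ + e₂ - + d₂ → e₁ ℕ.+ d₂ ≡ e₂ ℕ.+ d₁
equal-gaps d₁ e₁ d₂ e₂ gap = ℤP.+-injective (begin
    + e₁ +ℤ + d₂
  ≡⟨ solve 3 (λ a b c → b :+ c := (b :- a) :+ (a :+ c)) refl (+ d₁) (+ e₁) (+ d₂) ⟩
    (+ e₁ - + d₁) +ℤ (+ d₁ +ℤ + d₂)
  ≡⟨ cong (_+ℤ (+ d₁ +ℤ + d₂)) gap ⟩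
    (+ e₂ - + d₂) +ℤ (+ d₁ +ℤ + d₂)
  ≡⟨ solve 3 (λ a b c → (b :- c) :+ (a :+ c) := b :+ a) refl (+ d₁) (+ e₂) (+ d₂) ⟩
    + e₂ +ℤ + d₁
  ∎)
  where open ≡-Reasoning

equal-gap-product-< : ∀ (d₁ e₁ d₂ e₂ : ℕ) → d₁ < d₂ →
  e₁ ℕ.+ d₂ ≡ e₂ ℕ.+ d₁ → d₁ *ℕ e₁ < d₂ *ℕ e₂
equal-gap-product-< d₁ e₁ d₂ e₂ d₁<d₂ gap = ℕP.*-mono-< d₁<d₂ e₁<e₂
  where
  e₁<e₂ : e₁ < e₂
  e₁<e₂ = ℕP.+-cancelʳ-< d₁ e₁ e₂
            (ℕP.<-≤-trans (ℕP.+-monoʳ-< e₁ d₁<d₂) (ℕP.≤-reflexive gap))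

-- Two solutions (d₁, e₁), (d₂, e₂) of N² = (N - d)(N + e) with d₁ < d₂
-- have different gaps e - d: equal gaps would force d₁ e₁ = N (e - d) = d₂ e₂.
distinct-gaps : ∀ (N d₁ e₁ d₂ e₂ : ℕ) →
  + N *ℤ + N ≡ (+ N - + d₁) *ℤ (+ N +ℤ + e₁) →
  + N *ℤ + N ≡ (+ N - + d₂) *ℤ (+ N +ℤ + e₂) →
  d₁ < d₂ → + e₁ - + d₁ ≢ + e₂ - + d₂
distinct-gaps N d₁ e₁ d₂ e₂ hN₁ hN₂ d₁<d₂ gap =
  ℕP.<-irrefl equal-products (equal-gap-product-< d₁ e₁ d₂ e₂ d₁<d₂ (equal-gaps d₁ e₁ d₂ e₂ gap))
  where
  open ≡-Reasoning
  equal-products : d₁ *ℕ e₁ ≡ d₂ *ℕ e₂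
  equal-products = ℤP.+-injective (begin
      + (d₁ *ℕ e₁)           ≡⟨ ℤP.pos-* d₁ e₁ ⟩
      + d₁ *ℤ + e₁           ≡⟨ product-from-square (+ N) (+ d₁) (+ e₁) hN₁ ⟩
      + N *ℤ (+ e₁ - + d₁)   ≡⟨ cong (+ N *ℤ_) gap ⟩
      + N *ℤ (+ e₂ - + d₂)   ≡⟨ sym (product-from-square (+ N) (+ d₂) (+ e₂) hN₂) ⟩
      + d₂ *ℤ + e₂           ≡⟨ sym (ℤP.pos-* d₂ e₂) ⟩
      + (d₂ *ℕ e₂)           ∎)

scaled-gap-square-ℕ : ∀ (N d e μ x y : ℕ) → x ≤ y →
  + 2 *ℤ + N ≡ + μ *ℤ + x *ℤ + y →
  + 2 *ℤ (+ N - + d) ≡ + μ *ℤ (+ x *ℤ + x) →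
  + 2 *ℤ (+ N +ℤ + e) ≡ + μ *ℤ (+ y *ℤ + y) →
  + (μ *ℕ ((y ∸ℕ x) *ℕ (y ∸ℕ x))) ≡ + 2 *ℤ (+ e - + d)
scaled-gap-square-ℕ N d e μ x y x≤y hxy hxx hyy = begin
    + (μ *ℕ ((y ∸ℕ x) *ℕ (y ∸ℕ x)))
  ≡⟨ trans (ℤP.pos-* μ _) (cong (+ μ *ℤ_) (ℤP.pos-* (y ∸ℕ x) (y ∸ℕ x))) ⟩
    + μ *ℤ (+ (y ∸ℕ x) *ℤ + (y ∸ℕ x))
  ≡⟨ cong (λ c → + μ *ℤ (c *ℤ c)) (pos-∸ y x x≤y) ⟩
    + μ *ℤ ((+ y - + x) *ℤ (+ y - + x))
  ≡⟨ scaled-gap-square (+ N) (+ d) (+ e) (+ μ) (+ x) (+ y) hxy hxx hyy ⟩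
    + 2 *ℤ (+ e - + d)
  ∎
  where open ≡-Reasoning

lemma1 : (N r : ℕ) → 1 ≤ N → 2 ≤ r →
    (d e μ x y : Fin r → ℕ) →
    (∀ i → 1 ≤ d i) → (∀ i j → i <ᶠ j → d i < d j) →
    (∀ i → 1 ≤ e i) →
    (∀ i → + N *ℤ + N ≡ (+ N - + d i) *ℤ (+ N +ℤ + e i)) →
    (∀ i → 1 ≤ μ i) → (∀ i → 1 ≤ x i) → (∀ i → 1 ≤ y i) → (∀ i → x i < y i) →
    (∀ i → + 2 *ℤ + N ≡ + μ i *ℤ + x i *ℤ + y i) →
    (∀ i → + 2 *ℤ (+ N - + d i) ≡ + μ i *ℤ (+ x i *ℤ + x i)) →
    (∀ i → + 2 *ℤ (+ N +ℤ + e i) ≡ + μ i *ℤ (+ y i *ℤ + y i)) →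
    ∀ i j → i ≢ j →
    μ i *ℕ ((y i ∸ℕ x i) *ℕ (y i ∸ℕ x i)) ≢ μ j *ℕ ((y j ∸ℕ x j) *ℕ (y j ∸ℕ x j))
lemma1 N r _ _ d e μ x y _ d-increasing _ hN _ _ _ x<y hxy hxx hyy i j i≢j same =
  indices-coincide
  where
  gap-formula : ∀ k → + (μ k *ℕ ((y k ∸ℕ x k) *ℕ (y k ∸ℕ x k))) ≡ + 2 *ℤ (+ e k - + d k)
  gap-formula k = scaled-gap-square-ℕ N (d k) (e k) (μ k) (x k) (y k)
                    (ℕP.<⇒≤ (x<y k)) (hxy k) (hxx k) (hyy k)

  same-gap : ∀ a b → μ a *ℕ ((y a ∸ℕ x a) *ℕ (y a ∸ℕ x a)) ≡ μ b *ℕ ((y b ∸ℕ x b) *ℕ (y b ∸ℕ x b)) →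
             + e a - + d a ≡ + e b - + d b
  same-gap a b eq = ℤP.*-cancelˡ-≡ (+ 2) _ _
                      (trans (sym (gap-formula a)) (trans (cong +_ eq) (gap-formula b)))

  indices-coincide : ⊥
  indices-coincide with <-cmp i j
  ... | tri< i<j _ _ = distinct-gaps N (d i) (e i) (d j) (e j) (hN i) (hN j)
                         (d-increasing i j i<j) (same-gap i j same)
  ... | tri≈ _ i≡j _ = i≢j i≡j
  ... | tri> _ _ j<i = distinct-gaps N (d j) (e j) (d i) (e i) (hN j) (hN i)
                         (d-increasing j i j<i) (same-gap j i (sym same))
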